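{- $\mathcal{L}(\nabla,\bullet)$ is less expressive than $\mathcal{L}(\Diamond)$ on each of the following classes of models: all models ($\mathcal{K}$-models), symmetric models ($\mathcal{B}$-models), transitive models ($4$-models), and Euclidean models ($5$-models). On the class of reflexive models ($\mathcal{T}$-models), $\mathcal{L}(\nabla,\bullet)$ and $\mathcal{L}(\Diamond)$ are equally expressive.
   Context: Fix a nonempty set $\mathbf{P}$ of propositional variables. $\mathcal{L}(\nabla,\bullet)$: $\varphi::=p\mid\neg\varphi\mid\varphi\land\varphi\mid\nabla\varphi\mid\bullet\varphi$; $\mathcal{L}(\Diamond)$: $\varphi::=p\mid\neg\varphi\mid\varphi\land\varphi\mid\Diamond\varphi$ ($p\in\mathbf{P}$). A model is $\mathcal{M}=\langle S,R,V\rangle$ with $S$ nonempty, $R\subseteq S\times S$, $V:\mathbf{P}\to\mathcal{P}(S)$. Truth: $\mathcal{M},s\vDash p$ iff $s\in V(p)$; Booleans as usual; $\mathcal{M},s\vDash\nabla\varphi$ iff there are $t,u$ with $sRt$, $sRu$, $\mathcal{M},t\vDash\varphi$, $\mathcal{M},u\nvDash\varphi$; $\mathcal{M},s\vDash\bullet\varphi$ iff $\mathcal{M},s\vDash\varphi$ and some $t$ with $sRt$ has $\mathcal{M},t\nvDash\varphi$; $\mathcal{M},s\vDash\Diamond\varphi$ iff some $t$ with $sRt$ has $\mathcal{M},t\vDash\varphi$. For languages $L_1,L_2$ and a class $C$ of models: $L_2$ is at least as expressive as $L_1$ on $C$ if for every $\varphi\in L_1$ there is $\psi\in L_2$ such that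 $\mathcal{M},s\vDash\varphi\iff\mathcal{M},s\vDash\psi$ for all $\mathcal{M}\in C$ and states $s$; they are equally expressive if each is at least as expressive as the other; $L_1$ is less expressive than $L_2$ if $L_2$ is at least as expressive as $L_1$ but not conversely. -}

module Defs where

open import Level using (0ℓ)
open import Data.Product using (Σ; ∃; ∃-syntax; _×_; _,_)
open import Relation.Nullary using (¬_)
open import Function.Bundles using (_⇔_)
open import Data.Unit using (⊤)

record Model (P : Set) : Set₁ where
  field
    S       : Set
    inhabit : S
    R       : S → S → Set
    V       : P → S → Set
open Model public

data Form∇• (P : Set) : Set where
  var : P → Form∇• P
  ¬'_ : Form∇• P → Form∇• P
  _∧'_ : Form∇• P → Form∇• P → Form∇• P
  ∇_  : Form∇• P → Form∇• P
  •_  : Form∇• P → Form∇• P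

data Form◇ (P : Set) : Set where
  var : P → Form◇ P
  ¬'_ : Form◇ P → Form◇ P
  _∧'_ : Form◇ P → Form◇ P → Form◇ P
  ◇_  : Form◇ P → Form◇ P

sat∇• : {P : Set} (M : Model P) → S M → Form∇• P → Set
sat∇• M s (var p)   = V M p s
sat∇• M s (¬' φ)    = ¬ sat∇• M s φ
sat∇• M s (φ ∧' ψ)  = sat∇• M s φ × sat∇• M s ψ
sat∇• M s (∇ φ)     = ∃[ t ] ∃[ u ] (R M s t × R M s u × sat∇• M t φ × ¬ sat∇• M u φ)
sat∇• M s (• φ)     = sat∇• M s φ × (∃[ t ] (R M s t × ¬ sat∇• M t φ))

sat◇ : {P : Set} (M : Model P) → S M → Form◇ P → Set
sat◇ M s (var p)   = V M p s
sat◇ M s (¬' φ)    = ¬ sat◇ M s φ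
sat◇ M s (φ ∧' ψ)  = sat◇ M s φ × sat◇ M s ψ
sat◇ M s (◇ φ)     = ∃[ t ] (R M s t × sat◇ M t φ)

ModelClass : Set → Set₁
ModelClass P = Model P → Set

allModels : {P : Set} → ModelClass P
allModels M = ⊤

reflexive : {P : Set} → ModelClass P
reflexive M = ∀ s → R M s s

symmetric : {P : Set} → ModelClass P
symmetric M = ∀ s t → R M s t → R M t s

transitive : {P : Set} → ModelClass P
transitive M = ∀ s t u → R M s t → R M t u → R M s u

euclidean : {P : Set} → ModelClass P
euclidean M = ∀ s t u → R M s t → R M s u → R M t u

-- Expressivity.  L₂ (with satisfaction sat₂) is at least as expressive as
-- L₁ (with sat₁) on the class C.
AtLeastAsExpressive : {P : Set} (C : ModelClass P)
  (L₁ : Set) (sat₁ : (M : Model P) → S M → L₁ → Set)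
  (L₂ : Set) (sat₂ : (M : Model P) → S M → L₂ → Set) → Set₁
AtLeastAsExpressive {P} C L₁ sat₁ L₂ sat₂ =
  (φ : L₁) → Σ L₂ λ ψ → (M : Model P) → C M → (s : S M) → sat₁ M s φ ⇔ sat₂ M s ψ

EquallyExpressive : {P : Set} (C : ModelClass P)
  (L₁ : Set) (sat₁ : (M : Model P) → S M → L₁ → Set)
  (L₂ : Set) (sat₂ : (M : Model P) → S M → L₂ → Set) → Set₁
EquallyExpressive C L₁ sat₁ L₂ sat₂ =
  AtLeastAsExpressive C L₁ sat₁ L₂ sat₂ × AtLeastAsExpressive C L₂ sat₂ L₁ sat₁

LessExpressive : {P : Set} (C : ModelClass P)
  (L₁ : Set) (sat₁ : (M : Model P) → S M → L₁ → Set)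
  (L₂ : Set) (sat₂ : (M : Model P) → S M → L₂ → Set) → Set₁
LessExpressive C L₁ sat₁ L₂ sat₂ =
  AtLeastAsExpressive C L₁ sat₁ L₂ sat₂ × ¬ AtLeastAsExpressive C L₂ sat₂ L₁ sat₁

∇•LessThan◇ : {P : Set} → ModelClass P → Set₁
∇•LessThan◇ {P} C = LessExpressive C (Form∇• P) sat∇• (Form◇ P) sat◇

∇•EqualTo◇ : {P : Set} → ModelClass P → Set₁
∇•EqualTo◇ {P} C = EquallyExpressive C (Form∇• P) sat∇• (Form◇ P) sat◇

-- Every ∇•-formula has a ◇-translation on all models: ∇φ says that φ holds at
-- some successor and fails at another, •φ that φ holds here and fails at some
-- successor.  Conversely ◇ cannot be recovered in general: at a state with at
-- most one successor ∇ and • are always false, so a single point with a loop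
-- and a single isolated point agree on every ∇•-formula but not on ◇p.  Both
-- point models are symmetric, transitive and Euclidean, but the isolated point
-- is not reflexive.  On reflexive models ◇φ is equivalent to φ ∨ ∇φ: if φ
-- fails at the current state s yet holds at a successor t, then s and t
-- witness ∇φ, since sRs.
module Submission where

open import Defs
open import Level using (0ℓ)
open import Data.Product using (_×_; _,_; proj₁; proj₂)
open import Data.Product.Function.NonDependent.Propositional using (_×-⇔_)
open import Data.Product.Function.Dependent.Propositional using (congˡ)
open import Axiom.ExcludedMiddle using (ExcludedMiddle)
open import Function.Bundles using (_⇔_; mk⇔; Equivalence)
open import Function.Construct.Identity using (⇔-id)
open import Function.Related.TypeIsomorphisms using (¬-cong-⇔)
open import Data.Unit using (⊤; tt)
open import Data.Empty using (⊥; ⊥-elim)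
open import Relation.Nullary using (¬_; yes; no)

open Equivalence

module _ {P : Set} where

  _∨'_ : Form∇• P → Form∇• P → Form∇• P
  φ ∨' ψ = ¬' ((¬' φ) ∧' (¬' ψ))

  ◇-translation : Form∇• P → Form◇ P
  ◇-translation (var p)  = var p
  ◇-translation (¬' φ)   = ¬' ◇-translation φ
  ◇-translation (φ ∧' ψ) = ◇-translation φ ∧' ◇-translation ψ
  ◇-translation (∇ φ)    = (◇ ◇-translation φ) ∧' (◇ (¬' ◇-translation φ))
  ◇-translation (• φ)    = ◇-translation φ ∧' (◇ (¬' ◇-translation φ))

  ◇-translation-correct : (M : Model P) (s : S M) (φ : Form∇• P) →
    sat∇• M s φ ⇔ sat◇ M s (◇-translation φ)
  ◇-translation-correct M s (var p)  = ⇔-id _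
  ◇-translation-correct M s (¬' φ)   = ¬-cong-⇔ (◇-translation-correct M s φ)
  ◇-translation-correct M s (φ ∧' ψ) =
    ◇-translation-correct M s φ ×-⇔ ◇-translation-correct M s ψ
  ◇-translation-correct M s (∇ φ)    = mk⇔
    (λ (t , u , sRt , sRu , φt , ¬φu) →
       (t , sRt , to (correct t) φt) , (u , sRu , to (¬-cong-⇔ (correct u)) ¬φu))
    (λ ((t , sRt , φt) , (u , sRu , ¬φu)) →
       t , u , sRt , sRu , from (correct t) φt , from (¬-cong-⇔ (correct u)) ¬φu)
    where correct = λ t → ◇-translation-correct M t φ
  ◇-translation-correct M s (• φ)    =
    ◇-translation-correct M s φ
      ×-⇔ congˡ λ {t} → ⇔-id _ ×-⇔ ¬-cong-⇔ (◇-translation-correct M t φ)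

  ∇•-translation : Form◇ P → Form∇• P
  ∇•-translation (var p)  = var p
  ∇•-translation (¬' φ)   = ¬' ∇•-translation φ
  ∇•-translation (φ ∧' ψ) = ∇•-translation φ ∧' ∇•-translation ψ
  ∇•-translation (◇ φ)    = ∇•-translation φ ∨' (∇ ∇•-translation φ)

  ∇•-translation-correct : ExcludedMiddle 0ℓ → (M : Model P) → reflexive M →
    (s : S M) (φ : Form◇ P) → sat◇ M s φ ⇔ sat∇• M s (∇•-translation φ)
  ∇•-translation-correct em M refl s (var p)  = ⇔-id _
  ∇•-translation-correct em M refl s (¬' φ)   =
    ¬-cong-⇔ (∇•-translation-correct em M refl s φ)
  ∇•-translation-correct em M refl s (φ ∧' ψ) =
    ∇•-translation-correct em M refl s φ ×-⇔ ∇•-translation-correct em M refl s ψ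
  ∇•-translation-correct em M refl s (◇ φ)    = mk⇔ ◇⇒φ∨∇φ φ∨∇φ⇒◇
    where
    correct = λ t → ∇•-translation-correct em M refl t φ

    ◇⇒φ∨∇φ : sat◇ M s (◇ φ) → sat∇• M s (∇•-translation (◇ φ))
    ◇⇒φ∨∇φ (t , sRt , φt) (¬φs , ¬∇φs) =
      ¬∇φs (t , s , sRt , refl s , to (correct t) φt , ¬φs)

    -- The hypothesis only refutes ¬◇φ, hence excluded middle.
    φ∨∇φ⇒◇ : sat∇• M s (∇•-translation (◇ φ)) → sat◇ M s (◇ φ)
    φ∨∇φ⇒◇ φ∨∇φ with em {sat◇ M s (◇ φ)}
    ... | yes ◇φ = ◇φ
    ... | no ¬◇φ = ⊥-elim (φ∨∇φ
      ( (λ φs → ¬◇φ (s , refl s , from (correct s) φs))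
      , (λ (t , _ , sRt , _ , φt , _) → ¬◇φ (t , sRt , from (correct t) φt))))

  ∇•AtMost◇ : (C : ModelClass P) → AtLeastAsExpressive C (Form∇• P) sat∇• (Form◇ P) sat◇
  ∇•AtMost◇ C φ = ◇-translation φ , λ M _ s → ◇-translation-correct M s φ

  ∇•EqualTo◇-reflexive : ExcludedMiddle 0ℓ → ∇•EqualTo◇ {P} reflexive
  ∇•EqualTo◇-reflexive em =
    ∇•AtMost◇ reflexive ,
    λ φ → ∇•-translation φ , λ M refl s → ∇•-translation-correct em M refl s φ

  point : (Reach : Set) → Model P
  point Reach = record { S = ⊤ ; inhabit = tt ; R = λ _ _ → Reach ; V = λ _ _ → ⊤ }

  loop isolated : Model P
  loop     = point ⊤
  isolated = point ⊥

  sat∇•-point-independent : (Reach₁ Reach₂ : Set) (φ : Form∇• P) →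
    sat∇• (point Reach₁) tt φ ⇔ sat∇• (point Reach₂) tt φ
  sat∇•-point-independent Reach₁ Reach₂ = go
    where
    go : (φ : Form∇• P) → sat∇• (point Reach₁) tt φ ⇔ sat∇• (point Reach₂) tt φ
    go (var p)  = ⇔-id _
    go (¬' φ)   = ¬-cong-⇔ (go φ)
    go (φ ∧' ψ) = go φ ×-⇔ go ψ
    go (∇ φ)    = mk⇔ (λ (_ , _ , _ , _ , φtt , ¬φtt) → ⊥-elim (¬φtt φtt))
                      (λ (_ , _ , _ , _ , φtt , ¬φtt) → ⊥-elim (¬φtt φtt))
    go (• φ)    = mk⇔ (λ (φtt , _ , _ , ¬φtt) → ⊥-elim (¬φtt φtt))
                      (λ (φtt , _ , _ , ¬φtt) → ⊥-elim (¬φtt φtt))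

  ◇-not-∇•-definable : P → (C : ModelClass P) → C loop → C isolated →
    ¬ AtLeastAsExpressive C (Form◇ P) sat◇ (Form∇• P) sat∇•
  ◇-not-∇•-definable p C loop∈C isolated∈C definable =
    proj₁ (proj₂ ◇p-at-isolated)
    where
    ψ = proj₁ (definable (◇ var p))
    ψ-defines = proj₂ (definable (◇ var p))

    ◇p-at-isolated : sat◇ isolated tt (◇ var p)
    ◇p-at-isolated = from (ψ-defines isolated isolated∈C tt)
      (to (sat∇•-point-independent ⊤ ⊥ ψ)
        (to (ψ-defines loop loop∈C tt) (tt , tt , tt)))

  ∇•LessThan◇-of-points : P → (C : ModelClass P) → C loop → C isolated → ∇•LessThan◇ C
  ∇•LessThan◇-of-points p C loop∈C isolated∈C =
    ∇•AtMost◇ C , ◇-not-∇•-definable p C loop∈C isolated∈C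

mainTheorem3 : ExcludedMiddle 0ℓ → (P : Set) → P →
    ∇•LessThan◇ {P} allModels × ∇•LessThan◇ {P} symmetric
      × ∇•LessThan◇ {P} transitive × ∇•LessThan◇ {P} euclidean
      × ∇•EqualTo◇ {P} reflexive
mainTheorem3 em P p =
  ∇•LessThan◇-of-points p allModels  tt                  tt ,
  ∇•LessThan◇-of-points p symmetric  (λ _ _ _ → tt)     (λ _ _ ()) ,
  ∇•LessThan◇-of-points p transitive (λ _ _ _ _ _ → tt) (λ _ _ _ ()) ,
  ∇•LessThan◇-of-points p euclidean  (λ _ _ _ _ _ → tt) (λ _ _ _ ()) ,
  ∇•EqualTo◇-reflexive em
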